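{- Let $a,b$ be integers with $3 \nmid a$ or $3 \nmid b$. Then $3 + 3\mathbf{i}$ cannot be written as the sum of 2 cubes of elements of $LQ_{a,b}$; that is, there are no $x,y \in LQ_{a,b}$ with $x^3 + y^3 = 3 + 3\mathbf{i}$.
   Context: For integers $a,b$, $LQ_{a,b}$ denotes the quaternion ring $\{\alpha_0 + \alpha_1 \mathbf{i} + \alpha_2 \mathbf{j} + \alpha_3 \mathbf{k} \mid \alpha_n \in \mathbb{Z}\}$ with multiplication determined by $\mathbf{i}^2 = -a$, $\mathbf{j}^2 = -b$, $\mathbf{i}\mathbf{j} = -\mathbf{j}\mathbf{i} = \mathbf{k}$. -}

module Defs where

open import Data.Integer using (ℤ; _+_; _*_; _-_; +_)

-- Elements α₀ + α₁ i + α₂ j + α₃ k of LQ_{a,b}, α_n ∈ ℤ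
record LQ : Set where
  constructor quat
  field
    re : ℤ
    ci : ℤ
    cj : ℤ
    ck : ℤ

open LQ public

_⊕_ : LQ → LQ → LQ
quat x0 x1 x2 x3 ⊕ quat y0 y1 y2 y3 =
  quat (x0 + y0) (x1 + y1) (x2 + y2) (x3 + y3)

-- Multiplication in LQ_{a,b}, determined (bilinearly) by
-- i² = -a, j² = -b, ij = -ji = k.  Consequently
-- k² = -ab, ik = -a j, ki = a j, jk = b i, kj = -b i.
mulLQ : ℤ → ℤ → LQ → LQ → LQ
mulLQ a b (quat x0 x1 x2 x3) (quat y0 y1 y2 y3) =
  quat (x0 * y0 - a * (x1 * y1) - b * (x2 * y2) - (a * b) * (x3 * y3))
       (x0 * y1 + x1 * y0 + b * (x2 * y3) - b * (x3 * y2))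
       (x0 * y2 + x2 * y0 + a * (x3 * y1) - a * (x1 * y3))
       (x0 * y3 + x3 * y0 + x1 * y2 - x2 * y1)

cubeLQ : ℤ → ℤ → LQ → LQ
cubeLQ a b x = mulLQ a b (mulLQ a b x x) x

three+3i : LQ
three+3i = quat (+ 3) (+ 3) (+ 0) (+ 0)

module Submission where

-- Write x = x₀ + u with u pure, and let N(u) = a u₁² + b u₂² + ab u₃²
-- be the norm form on pure quaternions, with polarisation ⟨u , w⟩.  Since u² = -N(u),
--   x³ = (x₀³ - 3x₀ N(u)) + (3x₀² - N(u)) u .
-- So x³ + y³ = 3 + 3i (with n = N(u), m = N(w)) says
--   (R)  x₀³ - 3x₀n + y₀³ - 3y₀m = 3 ,      (V)  (3x₀² - n) u + (3y₀² - m) w = 3i .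
-- Pairing (V) with u and with w gives, modulo 3,
--   n² + m⟨u,w⟩ ≡ 0   and   n⟨u,w⟩ + m² ≡ 0 ,
-- which forces n ≡ m (mod 3) (an exhaustive check of residues mod 3).  Then (R) is
-- impossible modulo 9 (an exhaustive check of residues mod 9).

open import Defs
open import Data.Integer using (ℤ; +_)
open import Data.Integer.Divisibility using (_∣_)
open import Data.Sum using (_⊎_)
open import Data.Product using (∃₂)
open import Relation.Nullary using (¬_)
open import Relation.Binary.PropositionalEquality using (_≡_)

open import Data.Nat using (suc)
open import Data.Integer using (_+_; _*_; _-_; -_)
open import Data.Integer.Properties using (+-inverseʳ)
import Data.Integer.Divisibility.Signed as Signed
open Signed using (divides; _∣?_; ∣m∣n⇒∣m+n; ∣m∣n⇒∣m-n; ∣m⇒∣m*n; ∣n⇒∣m*n; ∣m⇒∣-m)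
open import Data.Integer.DivMod using (_%_; _/_; a≡a%n+[a/n]*n; n%d<d)
open import Data.Integer.Tactic.RingSolver using (solve-∀)
open import Data.Fin using (Fin; toℕ; fromℕ<)
open import Data.Fin.Properties using (all?; toℕ-fromℕ<)
open import Data.Product using (_,_)
open import Relation.Nullary using (Dec)
open import Relation.Nullary.Decidable using (¬?; _→-dec_; from-yes; map′)
open import Relation.Binary.PropositionalEquality using (refl; sym; trans; cong; cong₂; subst; module ≡-Reasoning)

infix 4 _≡_mod_
record _≡_mod_ (x y d : ℤ) : Set where
  constructor mod-intro
  field divides-difference : d Signed.∣ (x - y)
open _≡_mod_

module Congruence {d : ℤ} where

  mod-reflexive : ∀ {x y} → x ≡ y → x ≡ y mod d
  mod-reflexive {x} refl = mod-intro (subst (d Signed.∣_) (sym (+-inverseʳ x)) (divides (+ 0) refl))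

  mod-refl : ∀ x → x ≡ x mod d
  mod-refl x = mod-reflexive refl

  mod-sym : ∀ {x y} → x ≡ y mod d → y ≡ x mod d
  mod-sym {x} {y} (mod-intro h) = mod-intro (subst (d Signed.∣_) (flip x y) (∣m⇒∣-m h))
    where
    flip : ∀ x y → - (x - y) ≡ y - x
    flip = solve-∀

  mod-trans : ∀ {x y z} → x ≡ y mod d → y ≡ z mod d → x ≡ z mod d
  mod-trans {x} {y} {z} (mod-intro h) (mod-intro k) = mod-intro (subst (d Signed.∣_) (telescope x y z) (∣m∣n⇒∣m+n h k))
    where
    telescope : ∀ x y z → (x - y) + (y - z) ≡ x - z
    telescope = solve-∀

  mod-+ : ∀ {x y x′ y′} → x ≡ x′ mod d → y ≡ y′ mod d → x + y ≡ x′ + y′ mod d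
  mod-+ {x} {y} {x′} {y′} (mod-intro h) (mod-intro k) = mod-intro (subst (d Signed.∣_) (regroup x y x′ y′) (∣m∣n⇒∣m+n h k))
    where
    regroup : ∀ x y x′ y′ → (x - x′) + (y - y′) ≡ (x + y) - (x′ + y′)
    regroup = solve-∀

  mod-- : ∀ {x y x′ y′} → x ≡ x′ mod d → y ≡ y′ mod d → x - y ≡ x′ - y′ mod d
  mod-- {x} {y} {x′} {y′} (mod-intro h) (mod-intro k) = mod-intro (subst (d Signed.∣_) (regroup x y x′ y′) (∣m∣n⇒∣m-n h k))
    where
    regroup : ∀ x y x′ y′ → (x - x′) - (y - y′) ≡ (x - y) - (x′ - y′)
    regroup = solve-∀

  mod-* : ∀ {x y x′ y′} → x ≡ x′ mod d → y ≡ y′ mod d → x * y ≡ x′ * y′ mod d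
  mod-* {x} {y} {x′} {y′} (mod-intro h) (mod-intro k) =
    mod-intro (subst (d Signed.∣_) (regroup x y x′ y′) (∣m∣n⇒∣m+n (∣n⇒∣m*n x k) (∣m⇒∣m*n y′ h)))
    where
    regroup : ∀ x y x′ y′ → x * (y - y′) + (x - x′) * y′ ≡ x * y - x′ * y′
    regroup = solve-∀

open Congruence

infix 4 _≟_mod_
_≟_mod_ : ∀ x y d → Dec (x ≡ y mod d)
x ≟ y mod d = map′ mod-intro divides-difference (d ∣? (x - y))

mod-scale : ∀ k {x y d} → x ≡ y mod d → k * x ≡ k * y mod (k * d)
mod-scale k {x} {y} {d} (mod-intro (divides q x-y≡qd)) = mod-intro (divides q (begin
  k * x - k * y   ≡⟨ factor k x y ⟩
  k * (x - y)     ≡⟨ cong (k *_) x-y≡qd ⟩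
  k * (q * d)     ≡⟨ swap k q d ⟩
  q * (k * d)     ∎))
  where
  open ≡-Reasoning
  factor : ∀ k x y → k * x - k * y ≡ k * (x - y)
  factor = solve-∀
  swap : ∀ k q d → k * (q * d) ≡ q * (k * d)
  swap = solve-∀

residue : ∀ k → ℤ → Fin (suc k)
residue k z = fromℕ< (n%d<d z (+ suc k))

⟦_⟧ : ∀ {k} → Fin k → ℤ
⟦ r ⟧ = + toℕ r

residue-correct : ∀ k z → z ≡ ⟦ residue k z ⟧ mod + suc k
residue-correct k z rewrite toℕ-fromℕ< (n%d<d z (+ suc k)) = mod-intro (divides (z / + suc k) z-minus-remainder)
  where
  open ≡-Reasoning
  cancel : ∀ r q → (r + q) - r ≡ q
  cancel = solve-∀
  z-minus-remainder : z - + (z % + suc k) ≡ (z / + suc k) * + suc k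
  z-minus-remainder = begin
    z - + (z % + suc k)                                  ≡⟨ cong (_- + (z % + suc k)) (a≡a%n+[a/n]*n z (+ suc k)) ⟩
    (+ (z % + suc k) + (z / + suc k) * + suc k) - + (z % + suc k) ≡⟨ cancel (+ (z % + suc k)) ((z / + suc k) * + suc k) ⟩
    (z / + suc k) * + suc k                              ∎

-- The bilinear form ⟨u , w⟩ = a u₁w₁ + b u₂w₂ + ab u₃w₃ on the pure parts; the norm
-- of a pure quaternion u is ⟨u , u⟩ (indeed u² = -⟨u , u⟩).
form : ℤ → ℤ → LQ → LQ → ℤ
form a b u w = a * (ci u * ci w) + b * (cj u * cj w) + (a * b) * (ck u * ck w)

along : ℤ → ℤ → LQ → LQ
along s t x = quat s (t * ci x) (t * cj x) (t * ck x)

quat-cong : ∀ {r i j k r′ i′ j′ k′} → r ≡ r′ → i ≡ i′ → j ≡ j′ → k ≡ k′ → quat r i j k ≡ quat r′ i′ j′ k′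
quat-cong refl refl refl refl = refl

-- x² = (x₀² - N(u)) + 2x₀ u, because u² = -N(u) and u commutes with x₀.
square-formula : ∀ a b x → mulLQ a b x x ≡ along (re x * re x - form a b x x) (+ 2 * re x) x
square-formula a b (quat x0 x1 x2 x3) =
  quat-cong (real a b x0 x1 x2 x3) (pure b x0 x1 x2 x3) (pure a x0 x2 x3 x1) (pure-k x0 x1 x2 x3)
  where
  real : ∀ a b x0 x1 x2 x3 → x0 * x0 - a * (x1 * x1) - b * (x2 * x2) - (a * b) * (x3 * x3)
                              ≡ x0 * x0 - (a * (x1 * x1) + b * (x2 * x2) + (a * b) * (x3 * x3))
  real = solve-∀
  pure : ∀ c x0 v w z → x0 * v + v * x0 + c * (w * z) - c * (z * w) ≡ + 2 * x0 * v
  pure = solve-∀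
  pure-k : ∀ x0 x1 x2 x3 → x0 * x3 + x3 * x0 + x1 * x2 - x2 * x1 ≡ + 2 * x0 * x3
  pure-k = solve-∀

-- Elements s + t·u and x₀ + u multiply like complex numbers with u² = -N(u):
-- (s + t u)(x₀ + u) = (s x₀ - t N(u)) + (s + t x₀) u.
coaxial-product : ∀ a b s t x →
  mulLQ a b (along s t x) x ≡ along (s * re x - t * form a b x x) (s + t * re x) x
coaxial-product a b s t (quat x0 x1 x2 x3) =
  quat-cong (real a b s t x0 x1 x2 x3) (pure b s t x0 x1 x2 x3) (pure a s t x0 x2 x3 x1) (pure-k s t x0 x1 x2 x3)
  where
  real : ∀ a b s t x0 x1 x2 x3 →
    s * x0 - a * (t * x1 * x1) - b * (t * x2 * x2) - (a * b) * (t * x3 * x3)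
      ≡ s * x0 - t * (a * (x1 * x1) + b * (x2 * x2) + (a * b) * (x3 * x3))
  real = solve-∀
  pure : ∀ c s t x0 v w z → s * v + t * v * x0 + c * (t * w * z) - c * (t * z * w) ≡ (s + t * x0) * v
  pure = solve-∀
  pure-k : ∀ s t x0 x1 x2 x3 → s * x3 + t * x3 * x0 + t * x1 * x2 - t * x2 * x1 ≡ (s + t * x0) * x3
  pure-k = solve-∀

cube-by-parts : ℤ → ℤ → LQ → LQ
cube-by-parts a b x = along (re x * re x * re x - + 3 * re x * form a b x x) (+ 3 * re x * re x - form a b x x) x

cube-formula : ∀ a b x → cubeLQ a b x ≡ cube-by-parts a b x
cube-formula a b x = begin
  mulLQ a b (mulLQ a b x x) x                                        ≡⟨ cong (λ z → mulLQ a b z x) (square-formula a b x) ⟩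
  mulLQ a b (along (x0 * x0 - n) (+ 2 * x0) x) x                    ≡⟨ coaxial-product a b (x0 * x0 - n) (+ 2 * x0) x ⟩
  along ((x0 * x0 - n) * x0 - + 2 * x0 * n) (x0 * x0 - n + + 2 * x0 * x0) x ≡⟨ cong₂ (λ r t → along r t x) (real x0 n) (coefficient x0 n) ⟩
  cube-by-parts a b x                                                ∎
  where
  open ≡-Reasoning
  x0 n : ℤ
  x0 = re x
  n = form a b x x
  real : ∀ x0 n → (x0 * x0 - n) * x0 - + 2 * x0 * n ≡ x0 * x0 * x0 - + 3 * x0 * n
  real = solve-∀
  coefficient : ∀ x0 n → x0 * x0 - n + + 2 * x0 * x0 ≡ + 3 * x0 * x0 - n
  coefficient = solve-∀

form-sym : ∀ a b u w → form a b u w ≡ form a b w u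
form-sym a b (quat _ u1 u2 u3) (quat _ w1 w2 w3) = commute a b u1 u2 u3 w1 w2 w3
  where
  commute : ∀ a b u1 u2 u3 w1 w2 w3 →
    a * (u1 * w1) + b * (u2 * w2) + (a * b) * (u3 * w3) ≡ a * (w1 * u1) + b * (w2 * u2) + (a * b) * (w3 * u3)
  commute = solve-∀

-- Pairing the vector-part equation (3x₀² - n) x + (3y₀² - m) y = 3i with a pure u:
-- the left side pairs to 3(x₀²⟨x,u⟩ + y₀²⟨y,u⟩) - (n⟨x,u⟩ + m⟨y,u⟩), the right to 3a u₁.
pairing-mod-3 : ∀ a b x y n m u →
  let p = + 3 * re x * re x - n ; q = + 3 * re y * re y - m in
  p * ci x + q * ci y ≡ + 3 → p * cj x + q * cj y ≡ + 0 → p * ck x + q * ck y ≡ + 0 →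
  n * form a b x u + m * form a b y u ≡ + 0 mod + 3
pairing-mod-3 a b x@(quat x0 x1 x2 x3) y@(quat y0 y1 y2 y3) n m u@(quat _ u1 u2 u3) on-i on-j on-k =
  mod-intro (divides (A - a * u1) (trans (expand a b x0 x1 x2 x3 y0 y1 y2 y3 u1 u2 u3 n m) (vanish on-i on-j on-k)))
  where
  A : ℤ
  A = x0 * x0 * form a b x u + y0 * y0 * form a b y u
  weighted : ℤ → ℤ → ℤ → ℤ
  weighted s t r = a * u1 * s + b * u2 * t + (a * b) * u3 * r
  expand : ∀ a b x0 x1 x2 x3 y0 y1 y2 y3 u1 u2 u3 n m →
    let p = + 3 * x0 * x0 - n ; q = + 3 * y0 * y0 - m
        Fx = a * (x1 * u1) + b * (x2 * u2) + (a * b) * (x3 * u3)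
        Fy = a * (y1 * u1) + b * (y2 * u2) + (a * b) * (y3 * u3) in
    n * Fx + m * Fy - + 0 ≡
      + 3 * (x0 * x0 * Fx + y0 * y0 * Fy)
        - (a * u1 * (p * x1 + q * y1) + b * u2 * (p * x2 + q * y2) + (a * b) * u3 * (p * x3 + q * y3))
  expand = solve-∀
  collect : ∀ a b u1 u2 u3 A → + 3 * A - (a * u1 * + 3 + b * u2 * + 0 + (a * b) * u3 * + 0) ≡ (A - a * u1) * + 3
  collect = solve-∀
  vanish : ∀ {s t r} → s ≡ + 3 → t ≡ + 0 → r ≡ + 0 → + 3 * A - weighted s t r ≡ (A - a * u1) * + 3
  vanish refl refl refl = collect a b u1 u2 u3 A

-- Over ℤ/3: if n² + mB ≡ 0 and nB + m² ≡ 0 then n ≡ m.  (If n ≡ 0 then m² ≡ 0, and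
-- symmetrically; otherwise n² ≡ m² ≡ 1, so nB ≡ mB ≡ -1 and B is invertible.)
norms-agree-mod-3 : ∀ n m B → n * n + m * B ≡ + 0 mod + 3 → n * B + m * m ≡ + 0 mod + 3 → n ≡ m mod + 3
norms-agree-mod-3 n m B h₁ h₂ =
  mod-trans ρn (mod-trans (on-residues (residue 2 n) (residue 2 m) (residue 2 B) h₁′ h₂′) (mod-sym ρm))
  where
  ρn : n ≡ ⟦ residue 2 n ⟧ mod + 3
  ρn = residue-correct 2 n
  ρm : m ≡ ⟦ residue 2 m ⟧ mod + 3
  ρm = residue-correct 2 m
  ρB : B ≡ ⟦ residue 2 B ⟧ mod + 3
  ρB = residue-correct 2 B
  h₁′ : ⟦ residue 2 n ⟧ * ⟦ residue 2 n ⟧ + ⟦ residue 2 m ⟧ * ⟦ residue 2 B ⟧ ≡ + 0 mod + 3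
  h₁′ = mod-trans (mod-sym (mod-+ (mod-* ρn ρn) (mod-* ρm ρB))) h₁
  h₂′ : ⟦ residue 2 n ⟧ * ⟦ residue 2 B ⟧ + ⟦ residue 2 m ⟧ * ⟦ residue 2 m ⟧ ≡ + 0 mod + 3
  h₂′ = mod-trans (mod-sym (mod-+ (mod-* ρn ρB) (mod-* ρm ρm))) h₂
  on-residues : ∀ (n m B : Fin 3) →
    ⟦ n ⟧ * ⟦ n ⟧ + ⟦ m ⟧ * ⟦ B ⟧ ≡ + 0 mod + 3 → ⟦ n ⟧ * ⟦ B ⟧ + ⟦ m ⟧ * ⟦ m ⟧ ≡ + 0 mod + 3 → ⟦ n ⟧ ≡ ⟦ m ⟧ mod + 3
  on-residues = from-yes (all? {n = 3} λ n → all? {n = 3} λ m → all? {n = 3} λ B →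
    (⟦ n ⟧ * ⟦ n ⟧ + ⟦ m ⟧ * ⟦ B ⟧ ≟ + 0 mod + 3) →-dec
      ((⟦ n ⟧ * ⟦ B ⟧ + ⟦ m ⟧ * ⟦ m ⟧ ≟ + 0 mod + 3) →-dec (⟦ n ⟧ ≟ ⟦ m ⟧ mod + 3)))

-- The real part of x³ + y³ when x, y have real parts x₀, y₀ and pure norms n, m.
real-part : ℤ → ℤ → ℤ → ℤ → ℤ
real-part x0 y0 n m = (x0 * x0 * x0 - + 3 * x0 * n) + (y0 * y0 * y0 - + 3 * y0 * m)

-- If n ≡ m (mod 3), the real part is never 3 modulo 9.  (Modulo 3 it is x₀ + y₀, so
-- x₀ + y₀ ≡ 0; then x₀³ + y₀³ and 3n(x₀ + y₀) are both divisible by 9.)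
real-part-mod-9 : ∀ x0 y0 n m → n ≡ m mod + 3 → ¬ (real-part x0 y0 n m ≡ + 3 mod + 9)
real-part-mod-9 x0 y0 n m n≡m h =
  on-residues (residue 8 x0) (residue 8 y0) (residue 8 n) (mod-trans (mod-sym reduce) h)
  where
  ρx : x0 ≡ ⟦ residue 8 x0 ⟧ mod + 9
  ρx = residue-correct 8 x0
  ρy : y0 ≡ ⟦ residue 8 y0 ⟧ mod + 9
  ρy = residue-correct 8 y0
  ρn : n ≡ ⟦ residue 8 n ⟧ mod + 9
  ρn = residue-correct 8 n
  -- Since 3m ≡ 3n (mod 9), the term 3y₀m may be replaced by 3y₀n.
  replace-m : real-part x0 y0 n m ≡ real-part x0 y0 n n mod + 9
  replace-m = mod-+ (mod-refl (x0 * x0 * x0 - + 3 * x0 * n)) (mod-- (mod-refl (y0 * y0 * y0)) scaled)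
    where
    reassoc : ∀ y0 m → + 3 * y0 * m ≡ y0 * (+ 3 * m)
    reassoc = solve-∀
    scaled : + 3 * y0 * m ≡ + 3 * y0 * n mod + 9
    scaled = mod-trans (mod-reflexive (reassoc y0 m))
      (mod-trans (mod-* (mod-refl y0) (mod-scale (+ 3) (mod-sym n≡m))) (mod-reflexive (sym (reassoc y0 n))))
  reduce : real-part x0 y0 n m ≡ real-part ⟦ residue 8 x0 ⟧ ⟦ residue 8 y0 ⟧ ⟦ residue 8 n ⟧ ⟦ residue 8 n ⟧ mod + 9
  reduce = mod-trans replace-m
    (mod-+ (mod-- (mod-* (mod-* ρx ρx) ρx) (mod-* (mod-* (mod-refl (+ 3)) ρx) ρn))
           (mod-- (mod-* (mod-* ρy ρy) ρy) (mod-* (mod-* (mod-refl (+ 3)) ρy) ρn)))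
  on-residues : ∀ (x0 y0 n : Fin 9) → ¬ (real-part ⟦ x0 ⟧ ⟦ y0 ⟧ ⟦ n ⟧ ⟦ n ⟧ ≡ + 3 mod + 9)
  on-residues = from-yes (all? {n = 9} λ x0 → all? {n = 9} λ y0 → all? {n = 9} λ n →
    ¬? (real-part ⟦ x0 ⟧ ⟦ y0 ⟧ ⟦ n ⟧ ⟦ n ⟧ ≟ + 3 mod + 9))

mainTheorem10 : (a b : ℤ) → (¬ (+ 3 ∣ a) ⊎ ¬ (+ 3 ∣ b)) →
    ¬ ∃₂ (λ (x y : LQ) → (cubeLQ a b x ⊕ cubeLQ a b y) ≡ three+3i)
mainTheorem10 a b _ (x , y , cubes≡) = real-part-mod-9 (re x) (re y) n m n≡m (mod-reflexive (cong re expanded))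
  where
  n m : ℤ
  n = form a b x x
  m = form a b y y
  expanded : cube-by-parts a b x ⊕ cube-by-parts a b y ≡ three+3i
  expanded = trans (sym (cong₂ _⊕_ (cube-formula a b x) (cube-formula a b y))) cubes≡
  pairing : ∀ u → n * form a b x u + m * form a b y u ≡ + 0 mod + 3
  pairing u = pairing-mod-3 a b x y n m u (cong ci expanded) (cong cj expanded) (cong ck expanded)
  n≡m : n ≡ m mod + 3
  n≡m = norms-agree-mod-3 n m (form a b x y) (subst (λ B → n * n + m * B ≡ + 0 mod + 3) (form-sym a b y x) (pairing x)) (pairing y)
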